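{- There is an absolute constant $c>0$ such that the following holds. For every $n\ge1$ and every preorder initial tree $I_{pre}=\{(\pi(i),-i): i\in[n]\}$, where $\pi$ is a permutation of $[n]$ avoiding the pattern $(2,3,1)$, the search sequence $S=\mathcal{M}(I_{pre})=(\pi(1),\dots,\pi(n))$ is a preorder sequence and $\textsc{Greedy}_{I_{pre}}(S)\le c\,n$, i.e. $\textsc{Greedy}_{I_{pre}}(S)=O(n)$.
   Context: A permutation $(a_1,\dots,a_n)$ avoids the pattern $(2,3,1)$ if there are no indices $i<j<k$ with $a_k<a_i<a_j$; a preorder sequence is a permutation of $[n]$ avoiding $(2,3,1)$ (equivalently, the preorder traversal of some binary search tree on $[n]$). Geometric view of binary search trees: a search sequence $S=(s_1,\dots,s_n)$ is the point set $\{(s_i,i)\}$ (x = key, y = time); the mirror $\mathcal{M}(X)$ of a point set is its reflection across the $x$-axis, $(a,b)\mapsto(a,-b)$. An initial tree is a finite set of points with negative $y$-coordinates present before any search. For two points $p,q$ not on a common horizontal or vertical line, $\square_{pq}$ denotes the closed axis-parallel rectangle with corners $p,q$. The algorithm $\textsc{Greedy}$ with initial tree $I$ on $S$: start with $X:=I$; for $i=1,\dots,n$ in order, let $X_{<i}$ be the current set (all points with $y<i$); for every point $z\in X_{<i}$ with $z.x\neq s_i$ such that $\square_{(s_i,i)z}$ contains no point of $X_{<i}\cup\{(s_i,i)\}$ other than its two corners, add the point $(z.x,i)$ (a touched point); then add $(s_i,i)$ and all these touched points to $X$. The cost $\textsc{Greedy}_I(S)$ is $n$ plus the total number of touched points added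 over all times $1,\dots,n$. -}

module Defs where

open import Data.Nat as ℕ using (ℕ; suc; _<_)
open import Data.Integer as ℤ using (ℤ; +_; -_; _⊓_; _⊔_)
open import Data.Fin using (Fin; toℕ) renaming (_<_ to _<ᶠ_)
open import Data.Product using (_×_; _,_; proj₁; proj₂)
open import Data.Bool using (Bool; true; false; not; _∧_)
open import Data.List using (List; []; _∷_; _++_; map; length; filterᵇ; allFin)
open import Relation.Nullary using (¬_)
open import Relation.Nullary.Decidable using (⌊_⌋)
open import Function.Definitions using (Injective)
open import Relation.Binary.PropositionalEquality using (_≡_)

-- A point (x , y) : x = key, y = time.
Point : Set
Point = ℤ × ℤ

_==ℤ_ : ℤ → ℤ → Bool
a ==ℤ b = ⌊ a ℤ.≟ b ⌋

_≤ℤ_ : ℤ → ℤ → Bool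
a ≤ℤ b = ⌊ a ℤ.≤? b ⌋

_==ᵖ_ : Point → Point → Bool
(a , b) ==ᵖ (c , d) = (a ==ℤ c) ∧ (b ==ℤ d)

inRect : Point → Point → Point → Bool
inRect (px , py) (qx , qy) (wx , wy) =
  ((px ⊓ qx) ≤ℤ wx) ∧ (wx ≤ℤ (px ⊔ qx)) ∧ ((py ⊓ qy) ≤ℤ wy) ∧ (wy ≤ℤ (py ⊔ qy))

allᵇ : {A : Set} → (A → Bool) → List A → Bool
allᵇ p [] = true
allᵇ p (x ∷ xs) = p x ∧ allᵇ p xs

emptyRect : List Point → Point → Point → Bool
emptyRect Y p z = allᵇ (λ w → (w ==ᵖ p) ∨' (w ==ᵖ z) ∨' not (inRect p z w)) Y
  where
  _∨'_ : Bool → Bool → Bool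
  true ∨' _ = true
  false ∨' b = b
  infixr 5 _∨'_

touched : List Point → Point → List Point
touched X p =
  map (λ z → (proj₁ z , proj₂ p))
      (filterᵇ (λ z → not (proj₁ z ==ℤ proj₁ p) ∧ emptyRect (p ∷ X) p z) X)

greedyTouched : List Point → ℤ → List ℤ → ℕ
greedyTouched X t [] = 0
greedyTouched X t (s ∷ ss) =
  let p = (s , t) ; T = touched X p in
  length T ℕ.+ greedyTouched ((p ∷ T) ++ X) (t ℤ.+ + 1) ss

greedyCost : List Point → List ℤ → ℕ
greedyCost I S = length S ℕ.+ greedyTouched I (+ 1) S

searchPoints : List ℤ → List Point
searchPoints S = go (+ 1) S
  where
  go : ℤ → List ℤ → List Point
  go t [] = []
  go t (s ∷ ss) = (s , t) ∷ go (t ℤ.+ + 1) ss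

mirror : List Point → List Point
mirror = map (λ q → (proj₁ q , - proj₂ q))

-- Permutations of [n], encoded as injective maps Fin n → Fin n;
-- element i ∈ [n] corresponds to toℕ i + 1.
IsPermutation : (n : ℕ) → (Fin n → Fin n) → Set
IsPermutation n π = Injective _≡_ _≡_ π

Avoids231 : (n : ℕ) → (Fin n → Fin n) → Set
Avoids231 n π = ∀ (i j k : Fin n) → i <ᶠ j → j <ᶠ k → ¬ ((π k <ᶠ π i) × (π i <ᶠ π j))

IsPreorder : (n : ℕ) → (Fin n → Fin n) → Set
IsPreorder n π = IsPermutation n π × Avoids231 n π

val : {n : ℕ} → (Fin n → Fin n) → Fin n → ℤ
val π i = + suc (toℕ (π i))

preorderInitTree : (n : ℕ) → (Fin n → Fin n) → List Point
preorderInitTree n π = map (λ i → (val π i , - (+ suc (toℕ i)))) (allFin n)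

seqOf : (n : ℕ) → (Fin n → Fin n) → List ℤ
seqOf n π = map (val π) (allFin n)

-- Index the searches by position j (searched at time j + 1) and let σ j be the height of the
-- highest point in column key j; an unsearched column still has its initial height -(j + 1).
-- After the searches 0, …, P the tops form a peak at key P: they rise weakly towards it from the
-- left and fall strictly away from it on the right.  The search at time m + 1 touches exactly the
-- searched columns whose top is not hidden by a higher top strictly between them and key m.
-- If key m < key P, avoiding 231 leaves no searched key strictly between key m and key P, so
-- only P and the nearest searched key below key m are touched.  If key P < key m, every searched
-- key in [key P, key m) is touched, together with the nearest searched key above key m.  With
-- the potential Φ = number of searched keys to the right of the last searched one, every search
-- touches at most 3 points amortised, so Greedy costs at most n + 3n.

{-# OPTIONS --safe #-}

module Submission where

open import Defs
open import Data.Bool using (Bool; true; false; not; _∧_; T)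
open import Data.Empty using (⊥; ⊥-elim)
open import Data.Fin as Fin using (Fin; toℕ; fromℕ<)
import Data.Fin.Properties as Fin
open import Data.Integer as ℤ using (ℤ; +_; -[1+_]; _⊓_; _⊔_)
import Data.Integer.Properties as ℤ
open import Data.List using (List; []; _∷_; _++_; map; filter; length; applyUpTo; upTo; tabulate; allFin)
open import Data.List.Properties
  using (length-removeAt′; filter-none; length-map; map-applyUpTo; map-tabulate; length-applyUpTo)
open import Data.List.Membership.Propositional using (_∈_; _─_)
open import Data.List.Membership.Propositional.Properties
  using (∈-map⁺; ∈-map⁻; ∈-filter⁺; ∈-filter⁻; ∈-++⁺ˡ; ∈-++⁺ʳ; ∈-++⁻; ∈-upTo⁺; ∈-upTo⁻; ∈-applyUpTo⁺; ∈-applyUpTo⁻)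
open import Data.List.Relation.Binary.Subset.Propositional using (_⊆_)
open import Data.List.Relation.Unary.All as All using (All; []; _∷_)
import Data.List.Relation.Unary.All.Properties as All
open import Data.List.Relation.Unary.AllPairs using ([]; _∷_)
open import Data.List.Relation.Unary.Any using (here; there)
open import Data.List.Relation.Unary.Unique.Propositional using (Unique)
import Data.List.Relation.Unary.Unique.Propositional.Properties as Unique
open import Data.Nat as ℕ using (ℕ; zero; suc; z≤n; s≤s; _≤_; _<_; _≥_; _*_)
import Data.Nat.Properties as ℕ
open import Data.Nat.Tactic.RingSolver using (solve-∀)
open import Data.Product using (Σ; _×_; _,_; proj₁; proj₂; ∃-syntax)
open import Data.Sum using (_⊎_; inj₁; inj₂)
open import Data.Unit using (⊤; tt)
open import Function using (_∘_; id; _⇔_; mk⇔; Equivalence; case_of_)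
open import Level using (0ℓ)
open import Relation.Binary.Definitions using (tri<; tri≈; tri>)
open import Relation.Binary.PropositionalEquality
  using (_≡_; _≢_; refl; sym; trans; cong; cong₂; subst; subst₂; module ≡-Reasoning)
open import Relation.Nullary using (¬_; ¬?; yes; no; contradiction)
open import Relation.Nullary.Decidable as Dec using (_×-dec_; _⊎-dec_; T?)
open import Relation.Unary using (Pred; Decidable)

open Equivalence using (to; from)

-- Lists and counting

module _ {A : Set} where

  ∈-─ : ∀ {x y : A} {ys} (x∈ys : x ∈ ys) → y ∈ ys → y ≢ x → y ∈ ys ─ x∈ys
  ∈-─ (here refl) (here refl) y≢x = contradiction refl y≢x
  ∈-─ (here refl) (there y∈ys) _  = y∈ys
  ∈-─ (there _)   (here refl)  _  = here refl
  ∈-─ (there x∈ys) (there y∈ys) y≢x = there (∈-─ x∈ys y∈ys y≢x)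

  Unique⇒length≤ : ∀ {xs ys : List A} → Unique xs → xs ⊆ ys → length xs ≤ length ys
  Unique⇒length≤ {[]} _ _ = z≤n
  Unique⇒length≤ {x ∷ xs} {ys} (x∉xs ∷ xs!) x∷xs⊆ys = begin
    suc (length xs)          ≤⟨ s≤s (Unique⇒length≤ xs! xs⊆ys─x) ⟩
    suc (length (ys ─ x∈ys)) ≡⟨ length-removeAt′ ys _ ⟨
    length ys                ∎
    where
    open ℕ.≤-Reasoning
    x∈ys = x∷xs⊆ys (here refl)
    xs⊆ys─x : xs ⊆ ys ─ x∈ys
    xs⊆ys─x y∈xs = ∈-─ x∈ys (x∷xs⊆ys (there y∈xs)) (All.lookup x∉xs y∈xs ∘ sym)

  Unique-map⁺ : ∀ {B : Set} {f : A → B} {xs} → (∀ {x y} → x ∈ xs → y ∈ xs → f x ≡ f y → x ≡ y) →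
                Unique xs → Unique (map f xs)
  Unique-map⁺ _ [] = []
  Unique-map⁺ f-inj (x∉xs ∷ xs!) =
    All.map⁺ (All.tabulate λ y∈xs fx≡fy → All.lookup x∉xs y∈xs (f-inj (here refl) (there y∈xs) fx≡fy))
      ∷ Unique-map⁺ (λ x∈ y∈ → f-inj (there x∈) (there y∈)) xs!

  count : {P : Pred A 0ℓ} → Decidable P → List A → ℕ
  count P? xs = length (filter P? xs)

  module _ {P Q : Pred A 0ℓ} (P? : Decidable P) (Q? : Decidable Q) where

    count-mono : ∀ xs → (∀ {x} → x ∈ xs → P x → Q x) → count P? xs ≤ count Q? xs
    count-mono [] _ = z≤n
    count-mono (x ∷ xs) P⇒Q with ih ← count-mono xs (P⇒Q ∘ there) | P? x | Q? x
    ... | yes _  | yes _  = s≤s ih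
    ... | yes px | no ¬qx = contradiction (P⇒Q (here refl) px) ¬qx
    ... | no _   | yes _  = ℕ.m≤n⇒m≤1+n ih
    ... | no _   | no _   = ih

    count-∪ : ∀ xs → count (λ x → P? x ⊎-dec Q? x) xs ≤ count P? xs ℕ.+ count Q? xs
    count-∪ [] = z≤n
    count-∪ (x ∷ xs) with ih ← count-∪ xs | P? x | Q? x
    ... | yes _ | yes _ = s≤s (ℕ.≤-trans (ℕ.m≤n⇒m≤1+n ih) (ℕ.≤-reflexive (sym (ℕ.+-suc _ _))))
    ... | yes _ | no _  = s≤s ih
    ... | no _  | yes _ = ℕ.≤-trans (s≤s ih) (ℕ.≤-reflexive (sym (ℕ.+-suc _ _)))
    ... | no _  | no _  = ih

    count-∪-disjoint : ∀ xs → (∀ {x} → x ∈ xs → P x → ¬ Q x) →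
                       count P? xs ℕ.+ count Q? xs ≤ count (λ x → P? x ⊎-dec Q? x) xs
    count-∪-disjoint [] _ = z≤n
    count-∪-disjoint (x ∷ xs) P∩Q≡∅ with ih ← count-∪-disjoint xs (P∩Q≡∅ ∘ there) | P? x | Q? x
    ... | yes px | yes qx = contradiction qx (P∩Q≡∅ (here refl) px)
    ... | yes _  | no _   = s≤s ih
    ... | no _   | yes _  = ℕ.≤-trans (ℕ.≤-reflexive (ℕ.+-suc _ _)) (s≤s ih)
    ... | no _   | no _   = ih

  module _ {P Q R : Pred A 0ℓ} (P? : Decidable P) (Q? : Decidable Q) (R? : Decidable R) where

    count-⊆-∪ : ∀ xs → (∀ {x} → x ∈ xs → P x → Q x ⊎ R x) →
                count P? xs ≤ count Q? xs ℕ.+ count R? xs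
    count-⊆-∪ xs P⊆Q∪R =
      ℕ.≤-trans (count-mono P? (λ x → Q? x ⊎-dec R? x) xs P⊆Q∪R) (count-∪ Q? R? xs)

    count-disjoint-⊆ : ∀ xs → (∀ {x} → x ∈ xs → Q x → ¬ R x) → (∀ {x} → x ∈ xs → Q x ⊎ R x → P x) →
                       count Q? xs ℕ.+ count R? xs ≤ count P? xs
    count-disjoint-⊆ xs Q∩R≡∅ Q∪R⊆P =
      ℕ.≤-trans (count-∪-disjoint Q? R? xs Q∩R≡∅) (count-mono (λ x → Q? x ⊎-dec R? x) P? xs Q∪R⊆P)

  count-none : {P : Pred A 0ℓ} (P? : Decidable P) → ∀ xs → (∀ {x} → x ∈ xs → ¬ P x) →
               count P? xs ≡ 0
  count-none P? _ ¬P = cong length (filter-none P? (All.tabulate ¬P))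

  count≤1 : {P : Pred A 0ℓ} (P? : Decidable P) → ∀ xs → Unique xs →
            (∀ {x y} → x ∈ xs → y ∈ xs → P x → P y → x ≡ y) → count P? xs ≤ 1
  count≤1 P? [] _ _ = z≤n
  count≤1 {P} P? (x ∷ xs) (x∉xs ∷ xs!) P-single with P? x
  ... | no _   = count≤1 P? xs xs! (λ x∈ y∈ → P-single (there x∈) (there y∈))
  ... | yes px = s≤s (ℕ.≤-reflexive (count-none P? xs ¬P))
    where
    ¬P : ∀ {y} → y ∈ xs → ¬ P y
    ¬P y∈xs py = All.lookup x∉xs y∈xs (P-single (here refl) (there y∈xs) px py)

tabulate≡applyUpTo : ∀ {A : Set} {n} {f : Fin n → A} {g : ℕ → A} → (∀ i → f i ≡ g (toℕ i)) →
                     tabulate f ≡ applyUpTo g n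
tabulate≡applyUpTo {n = zero}  _   = refl
tabulate≡applyUpTo {n = suc n} f≡g = cong₂ _∷_ (f≡g Fin.zero) (tabulate≡applyUpTo (f≡g ∘ Fin.suc))

map-allFin≡applyUpTo : ∀ {A : Set} {n} {f : Fin n → A} {g : ℕ → A} → (∀ i → f i ≡ g (toℕ i)) →
                       map f (allFin n) ≡ applyUpTo g n
map-allFin≡applyUpTo {f = f} f≡g = trans (map-tabulate id f) (tabulate≡applyUpTo f≡g)

-- Rectangles and Greedy's touch test

InRange : ℤ → ℤ → ℤ → Set
InRange a b c = a ⊓ b ℤ.≤ c × c ℤ.≤ a ⊔ b

InRect : Point → Point → Point → Set
InRect (px , py) (qx , qy) (wx , wy) = InRange px qx wx × InRange py qy wy

Between : ℤ → ℤ → ℤ → Set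
Between a b c = (a ℤ.< b × b ℤ.< c) ⊎ (c ℤ.< b × b ℤ.< a)

Between-sym : ∀ {a b c} → Between a b c → Between c b a
Between-sym (inj₁ a<b<c) = inj₂ a<b<c
Between-sym (inj₂ c<b<a) = inj₁ c<b<a

Between⇒≢ : ∀ {a b c} → Between a b c → b ≢ a
Between⇒≢ (inj₁ (a<b , _)) b≡a = ℤ.<-irrefl (sym b≡a) a<b
Between⇒≢ (inj₂ (_ , b<a)) b≡a = ℤ.<-irrefl b≡a b<a

InRange-left : ∀ a b → InRange a b a
InRange-left a b = ℤ.i⊓j≤i a b , ℤ.i≤i⊔j a b

InRange-right : ∀ a b → InRange a b b
InRange-right a b = ℤ.i⊓j≤j a b , ℤ.i≤j⊔i a b

InRange⁺ : ∀ {a b c} → b ℤ.≤ c → c ℤ.≤ a → InRange a b c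
InRange⁺ {a} {b} b≤c c≤a = ℤ.≤-trans (ℤ.i⊓j≤j a b) b≤c , ℤ.≤-trans c≤a (ℤ.i≤i⊔j a b)

InRange⇒≤ : ∀ {a b c} → b ℤ.≤ a → InRange a b c → b ℤ.≤ c
InRange⇒≤ b≤a (a⊓b≤c , _) = subst (ℤ._≤ _) (ℤ.i≥j⇒i⊓j≡j b≤a) a⊓b≤c

Between⇒InRange : ∀ {a b c} → Between a b c → InRange a c b
Between⇒InRange {a} {b} {c} (inj₁ (a<b , b<c)) =
  ℤ.≤-trans (ℤ.i⊓j≤i a c) (ℤ.<⇒≤ a<b) , ℤ.≤-trans (ℤ.<⇒≤ b<c) (ℤ.i≤j⊔i a c)
Between⇒InRange {a} {b} {c} (inj₂ (c<b , b<a)) =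
  ℤ.≤-trans (ℤ.i⊓j≤j a c) (ℤ.<⇒≤ c<b) , ℤ.≤-trans (ℤ.<⇒≤ b<a) (ℤ.i≤i⊔j a c)

InRange⇒endpoint⊎Between : ∀ {a b c} → InRange a c b → b ≡ a ⊎ b ≡ c ⊎ Between a b c
InRange⇒endpoint⊎Between {a} {b} {c} (lo , hi) with ℤ.<-cmp a b | ℤ.<-cmp b c
... | tri≈ _ a≡b _ | _ = inj₁ (sym a≡b)
... | _ | tri≈ _ b≡c _ = inj₂ (inj₁ b≡c)
... | tri< a<b _ _ | tri< b<c _ _ = inj₂ (inj₂ (inj₁ (a<b , b<c)))
... | tri> _ _ b<a | tri> _ _ c<b = inj₂ (inj₂ (inj₂ (c<b , b<a)))
... | tri< a<b _ _ | tri> _ _ c<b with ℤ.⊔-sel a c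
...   | inj₁ a⊔c≡a = contradiction (subst (b ℤ.≤_) a⊔c≡a hi) (ℤ.<⇒≱ a<b)
...   | inj₂ a⊔c≡c = contradiction (subst (b ℤ.≤_) a⊔c≡c hi) (ℤ.<⇒≱ c<b)
InRange⇒endpoint⊎Between {a} {b} {c} (lo , hi) | tri> _ _ b<a | tri< b<c _ _ with ℤ.⊓-sel a c
...   | inj₁ a⊓c≡a = contradiction (subst (ℤ._≤ b) a⊓c≡a lo) (ℤ.<⇒≱ b<a)
...   | inj₂ a⊓c≡c = contradiction (subst (ℤ._≤ b) a⊓c≡c lo) (ℤ.<⇒≱ b<c)

T-inRect : ∀ p q w → T (inRect p q w) ⇔ InRect p q w
T-inRect (px , py) (qx , qy) (wx , wy) = mk⇔ sound complete
  where
  sound : T (inRect (px , py) (qx , qy) (wx , wy)) → InRect (px , py) (qx , qy) (wx , wy)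
  sound h with px ⊓ qx ℤ.≤? wx | wx ℤ.≤? px ⊔ qx | py ⊓ qy ℤ.≤? wy | wy ℤ.≤? py ⊔ qy
  ... | yes a | yes b | yes c | yes d = (a , b) , (c , d)
  ... | no _  | _     | _     | _     = ⊥-elim h
  ... | yes _ | no _  | _     | _     = ⊥-elim h
  ... | yes _ | yes _ | no _  | _     = ⊥-elim h
  ... | yes _ | yes _ | yes _ | no _  = ⊥-elim h
  complete : InRect (px , py) (qx , qy) (wx , wy) → T (inRect (px , py) (qx , qy) (wx , wy))
  complete ((a , b) , (c , d)) with px ⊓ qx ℤ.≤? wx | wx ℤ.≤? px ⊔ qx | py ⊓ qy ℤ.≤? wy | wy ℤ.≤? py ⊔ qy
  ... | yes _ | yes _ | yes _ | yes _ = tt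
  ... | no ¬a | _     | _     | _     = ¬a a
  ... | yes _ | no ¬b | _     | _     = ¬b b
  ... | yes _ | yes _ | no ¬c | _     = ¬c c
  ... | yes _ | yes _ | yes _ | no ¬d = ¬d d

T-==ᵖ : ∀ p q → T (p ==ᵖ q) ⇔ p ≡ q
T-==ᵖ (a , b) (c , d) = mk⇔ sound complete
  where
  sound : T ((a , b) ==ᵖ (c , d)) → (a , b) ≡ (c , d)
  sound h with a ℤ.≟ c | b ℤ.≟ d
  ... | yes refl | yes refl = refl
  ... | no _     | _        = ⊥-elim h
  ... | yes _    | no _     = ⊥-elim h
  complete : (a , b) ≡ (c , d) → T ((a , b) ==ᵖ (c , d))
  complete refl with a ℤ.≟ a | b ℤ.≟ b
  ... | yes _ | yes _ = tt
  ... | no ¬e | _     = ¬e refl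
  ... | yes _ | no ¬e = ¬e refl

EmptyRect : List Point → Point → Point → Set
EmptyRect Y p q = ∀ {w} → w ∈ Y → InRect p q w → w ≡ p ⊎ w ≡ q

-- `emptyRect` tests each point with a local disjunction that cannot be named, so it is
-- unfolded here by cases on the point.
T-emptyRect-∷ : ∀ w Y p q → T (emptyRect (w ∷ Y) p q) ⇔
                ((T (w ==ᵖ p) ⊎ T (w ==ᵖ q) ⊎ ¬ T (inRect p q w)) × T (emptyRect Y p q))
T-emptyRect-∷ w Y p q = mk⇔ sound complete
  where
  sound : T (emptyRect (w ∷ Y) p q) →
          (T (w ==ᵖ p) ⊎ T (w ==ᵖ q) ⊎ ¬ T (inRect p q w)) × T (emptyRect Y p q)
  sound h with w ==ᵖ p | w ==ᵖ q | inRect p q w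
  ... | true  | _     | _     = inj₁ tt , h
  ... | false | true  | _     = inj₂ (inj₁ tt) , h
  ... | false | false | false = inj₂ (inj₂ (λ ())) , h
  ... | false | false | true  = ⊥-elim h
  complete : (T (w ==ᵖ p) ⊎ T (w ==ᵖ q) ⊎ ¬ T (inRect p q w)) × T (emptyRect Y p q) →
             T (emptyRect (w ∷ Y) p q)
  complete (c , h) with w ==ᵖ p | w ==ᵖ q | inRect p q w | c
  ... | true  | _     | _     | _ = h
  ... | false | true  | _     | _ = h
  ... | false | false | false | _ = h
  ... | false | false | true  | inj₂ (inj₂ out) = out tt

T-emptyRect : ∀ Y p q → T (emptyRect Y p q) ⇔ EmptyRect Y p q
T-emptyRect [] p q = mk⇔ (λ _ ()) (λ _ → tt)
T-emptyRect (w ∷ Y) p q = mk⇔ sound complete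
  where
  sound : T (emptyRect (w ∷ Y) p q) → EmptyRect (w ∷ Y) p q
  sound h (here refl) inside with T-emptyRect-∷ w Y p q .to h
  ... | inj₁ w≡p , _            = inj₁ (T-==ᵖ w p .to w≡p)
  ... | inj₂ (inj₁ w≡q) , _     = inj₂ (T-==ᵖ w q .to w≡q)
  ... | inj₂ (inj₂ outside) , _ = contradiction (T-inRect p q w .from inside) outside
  sound h (there v∈Y) = T-emptyRect Y p q .to (proj₂ (T-emptyRect-∷ w Y p q .to h)) v∈Y
  complete : EmptyRect (w ∷ Y) p q → T (emptyRect (w ∷ Y) p q)
  complete empty = T-emptyRect-∷ w Y p q .from (head , T-emptyRect Y p q .from (empty ∘ there))
    where
    head : T (w ==ᵖ p) ⊎ T (w ==ᵖ q) ⊎ ¬ T (inRect p q w)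
    head with T? (inRect p q w)
    ... | no outside = inj₂ (inj₂ outside)
    ... | yes inside with empty (here refl) (T-inRect p q w .to inside)
    ...   | inj₁ w≡p = inj₁ (T-==ᵖ w p .from w≡p)
    ...   | inj₂ w≡q = inj₂ (inj₁ (T-==ᵖ w q .from w≡q))

greedyTest : List Point → Point → Point → Bool
greedyTest X p z = not (proj₁ z ==ℤ proj₁ p) ∧ emptyRect (p ∷ X) p z

TouchedBy : List Point → Point → Point → Set
TouchedBy X p z = proj₁ z ≢ proj₁ p × EmptyRect (p ∷ X) p z

T-greedyTest : ∀ X p z → T (greedyTest X p z) ⇔ TouchedBy X p z
T-greedyTest X p z = mk⇔ sound complete
  where
  sound : T (greedyTest X p z) → TouchedBy X p z
  sound h with proj₁ z ℤ.≟ proj₁ p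
  ... | no zx≢px = zx≢px , T-emptyRect (p ∷ X) p z .to h
  ... | yes _    = ⊥-elim h
  complete : TouchedBy X p z → T (greedyTest X p z)
  complete (zx≢px , empty) with proj₁ z ℤ.≟ proj₁ p
  ... | no _        = T-emptyRect (p ∷ X) p z .from empty
  ... | yes zx≡px   = contradiction zx≡px zx≢px

module _ {X : List Point} {p : Point} where

  ∈-touched⁻ : ∀ {v} → v ∈ touched X p → ∃[ z ] z ∈ X × TouchedBy X p z × v ≡ (proj₁ z , proj₂ p)
  ∈-touched⁻ v∈ with z , z∈ , refl ← ∈-map⁻ (λ z → proj₁ z , proj₂ p) v∈
    with z∈X , test ← ∈-filter⁻ (T? ∘ greedyTest X p) {xs = X} z∈ =
    z , z∈X , T-greedyTest X p z .to test , refl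

  ∈-touched⁺ : ∀ {z} → z ∈ X → TouchedBy X p z → (proj₁ z , proj₂ p) ∈ touched X p
  ∈-touched⁺ {z} z∈X touch =
    ∈-map⁺ (λ z → proj₁ z , proj₂ p) (∈-filter⁺ (T? ∘ greedyTest X p) z∈X (T-greedyTest X p z .from touch))

timed : ℤ → List ℤ → List Point
timed t []       = []
timed t (s ∷ ss) = (s , t) ∷ timed (t ℤ.+ + 1) ss

timed-unique : ∀ {G : ℤ → List ℤ → List Point} → (∀ t → G t [] ≡ []) →
               (∀ t s ss → G t (s ∷ ss) ≡ (s , t) ∷ G (t ℤ.+ + 1) ss) → ∀ t ss → G t ss ≡ timed t ss
timed-unique G[] G∷ t []       = G[] t
timed-unique {G} G[] G∷ t (s ∷ ss) =
  trans (G∷ t s ss) (cong ((s , t) ∷_) (timed-unique {G} G[] G∷ (t ℤ.+ + 1) ss))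

searchPoints≡timed : ∀ S → searchPoints S ≡ timed (+ 1) S
searchPoints≡timed S = by-cases S refl
  where
  -- `searchPoints` counts time with a local helper that cannot be named: `_` is solved to it
  -- by unification once `rewrite eq` has turned its first argument into the variable S.
  helper≡timed : ∀ t ss → _ ≡ timed t ss
  helper≡timed = timed-unique (λ _ → refl) (λ _ _ _ → refl)
  by-cases : ∀ S′ → S′ ≡ S → searchPoints S′ ≡ timed (+ 1) S′
  by-cases []       _  = refl
  by-cases (s ∷ ss) eq with + 2
  ... | t rewrite eq = cong ((s , + 1) ∷_) (helper≡timed t ss)

timed-applyUpTo : ∀ {f : ℕ → ℤ} {g : ℕ → Point} l m → (∀ i → g i ≡ (f i , + suc (i ℕ.+ m))) →
                  timed (+ suc m) (applyUpTo f l) ≡ applyUpTo g l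
timed-applyUpTo zero    _ _  = refl
timed-applyUpTo {f} (suc l) m g≡ =
  cong₂ _∷_ (sym (g≡ 0))
    (trans (cong (λ k → timed (+ suc k) (applyUpTo (f ∘ suc) l)) (ℕ.+-comm m 1))
           (timed-applyUpTo l (suc m) λ i →
              trans (g≡ (suc i)) (cong (λ k → f (suc i) , + suc k) (sym (ℕ.+-suc i m)))))

mirror-applyUpTo : ∀ n (key : ℕ → ℤ) →
                   mirror (applyUpTo (λ j → key j , -[1+ j ]) n) ≡ searchPoints (applyUpTo key n)
mirror-applyUpTo n key = begin
  mirror (applyUpTo (λ j → key j , -[1+ j ]) n) ≡⟨ map-applyUpTo _ _ n ⟩
  applyUpTo (λ j → key j , + suc j) n           ≡⟨ timed-applyUpTo n 0 stamp≡ ⟨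
  timed (+ 1) (applyUpTo key n)                 ≡⟨ searchPoints≡timed (applyUpTo key n) ⟨
  searchPoints (applyUpTo key n)                ∎
  where
  open ≡-Reasoning
  stamp≡ : ∀ i → (key i , + suc i) ≡ (key i , + suc (i ℕ.+ 0))
  stamp≡ i = cong (λ k → key i , + suc k) (sym (ℕ.+-identityʳ i))

-- Greedy on a 231-avoiding sequence, started from its mirrored initial tree

module GreedyOn231Avoiding
  (n : ℕ) (key : ℕ → ℤ)
  (key-injective : ∀ {i j} → i < n → j < n → key i ≡ key j → i ≡ j)
  (avoids-231 : ∀ {a b c} → a < b → b < c → c < n → key c ℤ.< key a → key a ℤ.< key b → ⊥)
  where

  positions : List ℕ
  positions = upTo n

  top : (ℕ → ℤ) → ℕ → Point
  top σ j = key j , σ j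

  record Peaked (P : ℕ) (σ : ℕ → ℤ) : Set where
    field
      peak    : σ P ≡ + suc P
      rising  : ∀ {i j} → i ≤ P → j ≤ P → key i ℤ.< key j → key j ℤ.≤ key P → σ i ℤ.≤ σ j
      falling : ∀ {i j} → i ≤ P → j ≤ P → key P ℤ.< key i → key i ℤ.< key j → σ j ℤ.< σ i

  PeakedAfter : ℕ → (ℕ → ℤ) → Set
  PeakedAfter zero    σ = ⊤
  PeakedAfter (suc P) σ = Peaked P σ

  -- Greedy's point set X after m searches; σ j is the height of the highest point in column key j.
  record Staircase (m : ℕ) (X : List Point) (σ : ℕ → ℤ) : Set where
    field
      on-column  : ∀ {w} → w ∈ X → ∃[ j ] j < n × proj₁ w ≡ key j × proj₂ w ℤ.≤ σ j
      top∈       : ∀ {j} → j < n → top σ j ∈ X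
      unique     : Unique X
      unsearched : ∀ {j} → m ≤ j → σ j ≡ -[1+ j ]
      searched   : ∀ {j} → j < m → + 1 ℤ.≤ σ j × σ j ℤ.≤ + m
      peaked     : PeakedAfter m σ

  RightOf : ℕ → Pred ℕ 0ℓ
  RightOf P j = j ≤ P × key P ℤ.< key j

  rightOf? : ∀ P → Decidable (RightOf P)
  rightOf? P j = j ℕ.≤? P ×-dec key P ℤ.<? key j

  Φ : ℕ → ℕ
  Φ zero    = 0
  Φ (suc P) = count (rightOf? P) positions

  module Step {m : ℕ} (m<n : m < n) {X : List Point} {σ : ℕ → ℤ} (stair : Staircase m X σ) where
    open Staircase stair

    t : ℤ
    t = + suc m

    p : Point
    p = key m , t

    σ≤m : ∀ j → σ j ℤ.≤ + m
    σ≤m j with j ℕ.<? m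
    ... | yes j<m = proj₂ (searched j<m)
    ... | no j≮m  = subst (ℤ._≤ + m) (sym (unsearched (ℕ.≮⇒≥ j≮m))) ℤ.-≤+

    σ<t : ∀ j → σ j ℤ.< t
    σ<t j = ℤ.≤-<-trans (σ≤m j) (ℤ.+<+ ℕ.≤-refl)

    unsearched<searched : ∀ {i j} → ¬ i < m → j < m → σ i ℤ.< σ j
    unsearched<searched {i} {j} i≮m j<m =
      subst (ℤ._< σ j) (sym (unsearched (ℕ.≮⇒≥ i≮m))) (ℤ.<-≤-trans ℤ.-<+ (proj₁ (searched j<m)))

    Visible : Pred ℕ 0ℓ
    Visible j = j < m × (∀ {l} → l < n → Between (key j) (key l) (key m) → σ l ℤ.< σ j)

    touched-is-top : ∀ {z} → z ∈ X → TouchedBy X p z → ∃[ j ] j < n × z ≡ top σ j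
    touched-is-top {z} z∈X (_ , empty) with j , j<n , zx≡keyj , zy≤σj ← on-column z∈X
      with empty (there (top∈ j<n))
             (subst (InRange (key m) (proj₁ z)) zx≡keyj (InRange-right (key m) (proj₁ z)) ,
              InRange⁺ zy≤σj (ℤ.<⇒≤ (σ<t j)))
    ... | inj₁ top≡p = contradiction (cong proj₂ top≡p) (ℤ.<⇒≢ (σ<t j))
    ... | inj₂ top≡z = j , j<n , sym top≡z

    touched⇒visible : ∀ {j} → j < n → TouchedBy X p (top σ j) → Visible j
    touched⇒visible {j} j<n (keyj≢keym , empty) = j<m , unblocked
      where
      inside⇒≡j : ∀ {l} → l < n → InRange (key m) (key j) (key l) → σ j ℤ.≤ σ l → l ≡ j
      inside⇒≡j {l} l<n x-inside σj≤σl
        with empty (there (top∈ l<n)) (x-inside , InRange⁺ σj≤σl (ℤ.<⇒≤ (σ<t l)))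
      ... | inj₁ top≡p = contradiction (cong proj₂ top≡p) (ℤ.<⇒≢ (σ<t l))
      ... | inj₂ top≡top = key-injective l<n j<n (cong proj₁ top≡top)

      j<m : j < m
      j<m with j ℕ.<? m
      ... | yes j<m = j<m
      ... | no j≮m =
        contradiction (cong key (inside⇒≡j m<n (InRange-left (key m) (key j)) σj≤σm)) (keyj≢keym ∘ sym)
        where
        σj≤σm : σ j ℤ.≤ σ m
        σj≤σm rewrite unsearched (ℕ.≮⇒≥ j≮m) | unsearched (ℕ.≤-refl {m}) = ℤ.-≤- (ℕ.≮⇒≥ j≮m)

      unblocked : ∀ {l} → l < n → Between (key j) (key l) (key m) → σ l ℤ.< σ j
      unblocked l<n btw = ℤ.≰⇒> λ σj≤σl →
        Between⇒≢ btw (cong key (inside⇒≡j l<n (Between⇒InRange (Between-sym btw)) σj≤σl))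

    visible⇒touched : ∀ {j} → Visible j → TouchedBy X p (top σ j)
    visible⇒touched {j} (j<m , unblocked) = keyj≢keym , empty
      where
      j<n = ℕ.<-trans j<m m<n
      keyj≢keym : key j ≢ key m
      keyj≢keym keyj≡keym = ℕ.<-irrefl (key-injective j<n m<n keyj≡keym) j<m
      empty : EmptyRect (p ∷ X) p (top σ j)
      empty (here refl) _ = inj₁ refl
      empty {wx , wy} (there w∈X) (x-inside , y-inside)
        with l , l<n , refl , wy≤σl ← on-column w∈X
        with InRange⇒endpoint⊎Between x-inside
      ... | inj₁ keyl≡keym with refl ← key-injective l<n m<n keyl≡keym =
        contradiction (ℤ.≤-trans σj≤wy wy≤σl) (ℤ.<⇒≱ (unsearched<searched (ℕ.<-irrefl refl) j<m))
        where σj≤wy = InRange⇒≤ (ℤ.<⇒≤ (σ<t j)) y-inside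
      ... | inj₂ (inj₁ keyl≡keyj) with refl ← key-injective l<n j<n keyl≡keyj =
        inj₂ (cong (key l ,_) (ℤ.≤-antisym wy≤σl (InRange⇒≤ (ℤ.<⇒≤ (σ<t j)) y-inside)))
      ... | inj₂ (inj₂ btw) =
        contradiction (ℤ.≤-trans (InRange⇒≤ (ℤ.<⇒≤ (σ<t j)) y-inside) wy≤σl)
                      (ℤ.<⇒≱ (unblocked l<n (Between-sym btw)))

    visible? : Decidable Visible
    visible? j with j ℕ.<? n
    ... | no j≮n  = no λ visible → j≮n (ℕ.<-trans (proj₁ visible) m<n)
    ... | yes j<n = Dec.map′ (touched⇒visible j<n ∘ T-greedyTest X p (top σ j) .to)
                             (T-greedyTest X p (top σ j) .from ∘ visible⇒touched)
                             (T? (greedyTest X p (top σ j)))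

    length-touched≤ : length (touched X p) ≤ count visible? positions
    length-touched≤ = begin
      length (touched X p)
        ≡⟨ length-map _ (filter test? X) ⟩
      length (filter test? X)
        ≤⟨ Unique⇒length≤ (Unique.filter⁺ test? unique) tested⊆tops ⟩
      length (map (top σ) (filter visible? positions))
        ≡⟨ length-map (top σ) (filter visible? positions) ⟩
      count visible? positions ∎
      where
      open ℕ.≤-Reasoning
      test? = T? ∘ greedyTest X p
      tested⊆tops : filter test? X ⊆ map (top σ) (filter visible? positions)
      tested⊆tops {z} z∈ with z∈X , test ← ∈-filter⁻ test? {xs = X} z∈
        with j , j<n , refl ← touched-is-top z∈X (T-greedyTest X p z .to test) =
        ∈-map⁺ (top σ)
          (∈-filter⁺ visible? (∈-upTo⁺ j<n) (touched⇒visible j<n (T-greedyTest X p z .to test)))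

    Raised : Pred ℕ 0ℓ
    Raised j = j ≡ m ⊎ Visible j

    raised? : Decidable Raised
    raised? j = j ℕ.≟ m ⊎-dec visible? j

    σ′ : ℕ → ℤ
    σ′ j with raised? j
    ... | yes _ = t
    ... | no _  = σ j

    σ′-raised : ∀ {j} → Raised j → σ′ j ≡ t
    σ′-raised {j} raised with raised? j
    ... | yes _      = refl
    ... | no ¬raised = contradiction raised ¬raised

    σ′-kept : ∀ {j} → ¬ Raised j → σ′ j ≡ σ j
    σ′-kept {j} ¬raised with raised? j
    ... | yes raised = contradiction raised ¬raised
    ... | no _       = refl

    σ≤σ′ : ∀ j → σ j ℤ.≤ σ′ j
    σ≤σ′ j with raised? j
    ... | yes _ = ℤ.<⇒≤ (σ<t j)
    ... | no _  = ℤ.≤-refl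

    σ′≤t : ∀ j → σ′ j ℤ.≤ t
    σ′≤t j with raised? j
    ... | yes _ = ℤ.≤-refl
    ... | no _  = ℤ.<⇒≤ (σ<t j)

    X′ : List Point
    X′ = p ∷ touched X p ++ X

    touched-is-raised-top : ∀ {w} → w ∈ touched X p → ∃[ j ] j < n × Visible j × w ≡ (key j , t)
    touched-is-raised-top w∈ with z , z∈X , touch , refl ← ∈-touched⁻ {X} {p} w∈
      with j , j<n , refl ← touched-is-top z∈X touch = j , j<n , touched⇒visible j<n touch , refl

    below-t : ∀ {w} → w ∈ X → proj₂ w ℤ.< t
    below-t w∈X with j , _ , _ , wy≤σj ← on-column w∈X = ℤ.≤-<-trans wy≤σj (σ<t j)

    on-column′ : ∀ {w} → w ∈ X′ → ∃[ j ] j < n × proj₁ w ≡ key j × proj₂ w ℤ.≤ σ′ j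
    on-column′ (here refl) = m , m<n , refl , ℤ.≤-reflexive (sym (σ′-raised (inj₁ refl)))
    on-column′ (there w∈) with ∈-++⁻ (touched X p) w∈
    ... | inj₁ w∈T with j , j<n , visible , refl ← touched-is-raised-top w∈T =
      j , j<n , refl , ℤ.≤-reflexive (sym (σ′-raised (inj₂ visible)))
    ... | inj₂ w∈X with j , j<n , wx≡keyj , wy≤σj ← on-column w∈X =
      j , j<n , wx≡keyj , ℤ.≤-trans wy≤σj (σ≤σ′ j)

    top∈′ : ∀ {j} → j < n → top σ′ j ∈ X′
    top∈′ {j} j<n with raised? j
    ... | yes (inj₁ refl)    = here refl
    ... | yes (inj₂ visible) = there (∈-++⁺ˡ (∈-touched⁺ (top∈ j<n) (visible⇒touched visible)))
    ... | no _               = there (∈-++⁺ʳ (touched X p) (top∈ j<n))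

    unique′ : Unique X′
    unique′ = All.tabulate p∉ ∷ Unique.++⁺ touched-unique unique touched∩X≡∅
      where
      p∉ : ∀ {w} → w ∈ touched X p ++ X → p ≢ w
      p∉ w∈ p≡w with ∈-++⁻ (touched X p) w∈
      ... | inj₁ w∈T with j , j<n , (j<m , _) , refl ← touched-is-raised-top w∈T =
        ℕ.<-irrefl (key-injective j<n m<n (sym (cong proj₁ p≡w))) j<m
      ... | inj₂ w∈X = ℤ.<-irrefl (cong proj₂ (sym p≡w)) (below-t w∈X)
      touched∩X≡∅ : ∀ {w} → ¬ (w ∈ touched X p × w ∈ X)
      touched∩X≡∅ (w∈T , w∈X) with _ , _ , _ , refl ← touched-is-raised-top w∈T =
        ℤ.<-irrefl refl (below-t w∈X)
      touched-unique : Unique (touched X p)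
      touched-unique = Unique-map⁺ same-column (Unique.filter⁺ (T? ∘ greedyTest X p) unique)
        where
        same-column : ∀ {z z′} → z ∈ filter (T? ∘ greedyTest X p) X → z′ ∈ filter (T? ∘ greedyTest X p) X →
                      (proj₁ z , t) ≡ (proj₁ z′ , t) → z ≡ z′
        same-column z∈ z′∈ same with z∈X , test ← ∈-filter⁻ (T? ∘ greedyTest X p) {xs = X} z∈
                                   | z′∈X , test′ ← ∈-filter⁻ (T? ∘ greedyTest X p) {xs = X} z′∈
          with j , j<n , refl ← touched-is-top z∈X (T-greedyTest X p _ .to test)
             | j′ , j′<n , refl ← touched-is-top z′∈X (T-greedyTest X p _ .to test′)
          with refl ← key-injective j<n j′<n (cong proj₁ same) = refl

    unsearched′ : ∀ {j} → suc m ≤ j → σ′ j ≡ -[1+ j ]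
    unsearched′ {j} m<j = trans (σ′-kept ¬raised) (unsearched (ℕ.<⇒≤ m<j))
      where
      ¬raised : ¬ Raised j
      ¬raised (inj₁ refl)      = ℕ.<-irrefl refl m<j
      ¬raised (inj₂ (j<m , _)) = ℕ.<-asym j<m m<j

    searched′ : ∀ {j} → j < suc m → + 1 ℤ.≤ σ′ j × σ′ j ℤ.≤ + suc m
    searched′ {j} j<1+m with ℕ.m≤n⇒m<n∨m≡n (ℕ.s≤s⁻¹ j<1+m)
    ... | inj₁ j<m  = ℤ.≤-trans (proj₁ (searched j<m)) (σ≤σ′ j) , σ′≤t j
    ... | inj₂ refl =
      ℤ.≤-trans (ℤ.+≤+ (s≤s z≤n)) (ℤ.≤-reflexive (sym (σ′-raised (inj₁ refl)))) , σ′≤t j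

    staircase′ : Peaked m σ′ → Staircase (suc m) X′ σ′
    staircase′ peaked′ = record
      { on-column = on-column′ ; top∈ = top∈′ ; unique = unique′
      ; unsearched = unsearched′ ; searched = searched′ ; peaked = peaked′ }

  module FirstStep (0<n : 0 < n) {X : List Point} {σ : ℕ → ℤ} (stair : Staircase 0 X σ) where
    open Step 0<n stair

    peaked′ : Peaked 0 σ′
    peaked′ = record
      { peak    = σ′-raised (inj₁ refl)
      ; rising  = λ { z≤n z≤n k<k _ → ⊥-elim (ℤ.<-irrefl refl k<k) }
      ; falling = λ { z≤n z≤n k<k _ → ⊥-elim (ℤ.<-irrefl refl k<k) } }

    amortised : length (touched X p) ℕ.+ Φ 1 ≤ 3 ℕ.+ Φ 0
    amortised = ℕ.≤-trans (ℕ.+-mono-≤ (ℕ.≤-trans length-touched≤ (ℕ.≤-reflexive nothing-visible))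
                                      (ℕ.≤-reflexive nothing-right))
                          z≤n
      where
      nothing-visible : count visible? positions ≡ 0
      nothing-visible = count-none visible? positions λ _ visible → ℕ.n≮0 (proj₁ visible)
      nothing-right : Φ 1 ≡ 0
      nothing-right = count-none (rightOf? 0) positions λ { _ (z≤n , k<k) → ℤ.<-irrefl refl k<k }

  module NextStep {P : ℕ} (m<n : suc P < n) {X : List Point} {σ : ℕ → ℤ}
                  (stair : Staircase (suc P) X σ) where
    open Step m<n stair
    open Peaked (Staircase.peaked stair)

    m : ℕ
    m = suc P

    P<m : P < m
    P<m = ℕ.≤-refl

    P<n : P < n
    P<n = ℕ.<-trans P<m m<n

    <m⇒≤P : ∀ {i} → i < m → i ≤ P
    <m⇒≤P = ℕ.s≤s⁻¹

    <m⇒<n : ∀ {i} → i < m → i < n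
    <m⇒<n i<m = ℕ.<-trans i<m m<n

    keyP≢keym : key P ≢ key m
    keyP≢keym keyP≡keym = ℕ.<-irrefl (key-injective P<n m<n keyP≡keym) P<m

    key≢keym : ∀ {i} → i < m → key i ≢ key m
    key≢keym i<m keyi≡keym = ℕ.<-irrefl (key-injective (<m⇒<n i<m) m<n keyi≡keym) i<m

    visible-not-past-P : ∀ {j} → Visible j → ¬ Between (key j) (key P) (key m)
    visible-not-past-P {j} (_ , unblocked) btw =
      ℤ.<⇒≱ (unblocked P<n btw) (subst (σ j ℤ.≤_) (sym peak) (σ≤m j))

    count≡P≤1 : count (ℕ._≟ P) positions ≤ 1
    count≡P≤1 = count≤1 (ℕ._≟ P) positions (Unique.upTo⁺ n) λ _ _ x≡P y≡P → trans x≡P (sym y≡P)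

    module Left (m<P : key m ℤ.< key P) where

      no-gap : ∀ {i} → i < m → key m ℤ.< key i → key i ℤ.< key P → ⊥
      no-gap i<m m<ᵏi i<ᵏP with ℕ.m≤n⇒m<n∨m≡n (<m⇒≤P i<m)
      ... | inj₁ i<P  = avoids-231 i<P P<m m<n m<ᵏi i<ᵏP
      ... | inj₂ refl = ℤ.<-irrefl refl i<ᵏP

      NearestBelow : Pred ℕ 0ℓ
      NearestBelow j = key j ℤ.< key m × (∀ {i} → i < m → key i ℤ.< key m → key i ℤ.≤ key j)

      visible-left : ∀ {j} → Visible j → j ≡ P ⊎ NearestBelow j
      visible-left {j} visible@(j<m , unblocked) with ℤ.<-cmp (key j) (key m)
      ... | tri≈ _ j≈m _ = contradiction j≈m (key≢keym j<m)
      ... | tri< j<ᵏm _ _ = inj₂ (j<ᵏm , nearest)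
        where
        nearest : ∀ {i} → i < m → key i ℤ.< key m → key i ℤ.≤ key j
        nearest i<m i<ᵏm = ℤ.≮⇒≥ λ j<ᵏi →
          ℤ.<⇒≱ (unblocked (<m⇒<n i<m) (inj₁ (j<ᵏi , i<ᵏm)))
                (rising (<m⇒≤P j<m) (<m⇒≤P i<m) j<ᵏi (ℤ.<⇒≤ (ℤ.<-trans i<ᵏm m<P)))
      ... | tri> _ _ m<ᵏj with ℤ.<-cmp (key j) (key P)
      ...   | tri< j<ᵏP _ _ = ⊥-elim (no-gap j<m m<ᵏj j<ᵏP)
      ...   | tri≈ _ j≈P _  = inj₁ (key-injective (<m⇒<n j<m) P<n j≈P)
      ...   | tri> _ _ P<ᵏj = contradiction (inj₂ (m<P , P<ᵏj)) (visible-not-past-P visible)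

      P-visible : Visible P
      P-visible = P<m , unblocked
        where
        unblocked : ∀ {l} → l < n → Between (key P) (key l) (key m) → σ l ℤ.< σ P
        unblocked _ (inj₁ (P<l , l<m)) = ⊥-elim (ℤ.<-asym (ℤ.<-trans P<l l<m) m<P)
        unblocked {l} _ (inj₂ (m<l , l<P)) with l ℕ.<? m
        ... | yes l<m = ⊥-elim (no-gap l<m m<l l<P)
        ... | no l≮m  = unsearched<searched l≮m P<m

      kept-right-of-P : ∀ {j} → j ≢ m → key P ℤ.< key j → σ′ j ≡ σ j
      kept-right-of-P {j} j≢m P<ᵏj = σ′-kept λ
        { (inj₁ j≡m) → j≢m j≡m
        ; (inj₂ visible) → case visible-left visible of λ
          { (inj₁ refl) → ℤ.<-irrefl refl P<ᵏj
          ; (inj₂ (j<ᵏm , _)) → ℤ.<-asym (ℤ.<-trans P<ᵏj j<ᵏm) m<P } }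

      kept-below-nearest : ∀ {i j} → j < m → key i ℤ.< key j → key j ℤ.< key m → σ′ i ≡ σ i
      kept-below-nearest j<m i<ᵏj j<ᵏm = σ′-kept λ
        { (inj₁ refl) → ℤ.<-asym i<ᵏj j<ᵏm
        ; (inj₂ visible) → case visible-left visible of λ
          { (inj₁ refl) → ℤ.<-asym (ℤ.<-trans i<ᵏj j<ᵏm) m<P
          ; (inj₂ (_ , nearest)) → ℤ.<⇒≱ i<ᵏj (nearest j<m j<ᵏm) } }

      rising′ : ∀ {i j} → i ≤ m → j ≤ m → key i ℤ.< key j → key j ℤ.≤ key m → σ′ i ℤ.≤ σ′ j
      rising′ {i} {j} i≤m j≤m i<ᵏj j≤ᵏm with ℕ.m≤n⇒m<n∨m≡n j≤m
      ... | inj₂ refl = subst (σ′ i ℤ.≤_) (sym (σ′-raised (inj₁ refl))) (σ′≤t i)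
      ... | inj₁ j<m = begin
        σ′ i ≡⟨ kept-below-nearest j<m i<ᵏj j<ᵏm ⟩
        σ i  ≤⟨ rising (<m⇒≤P i<m) (<m⇒≤P j<m) i<ᵏj (ℤ.<⇒≤ (ℤ.<-trans j<ᵏm m<P)) ⟩
        σ j  ≤⟨ σ≤σ′ j ⟩
        σ′ j ∎
        where
        open ℤ.≤-Reasoning
        j<ᵏm = ℤ.≤∧≢⇒< j≤ᵏm (key≢keym j<m)
        i<m : i < m
        i<m = ℕ.≤∧≢⇒< i≤m λ { refl → ℤ.<-asym i<ᵏj j<ᵏm }

      falling′ : ∀ {i j} → i ≤ m → j ≤ m → key m ℤ.< key i → key i ℤ.< key j → σ′ j ℤ.< σ′ i
      falling′ {i} {j} i≤m j≤m m<ᵏi i<ᵏj =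
        subst (ℤ._< σ′ i) (sym (kept-right-of-P j≢m P<ᵏj)) σj<σ′i
        where
        i<m : i < m
        i<m = ℕ.≤∧≢⇒< i≤m λ { refl → ℤ.<-irrefl refl m<ᵏi }
        j≢m : j ≢ m
        j≢m refl = ℤ.<-asym m<ᵏi i<ᵏj
        j<m = ℕ.≤∧≢⇒< j≤m j≢m
        P≤ᵏi : key P ℤ.≤ key i
        P≤ᵏi = ℤ.≮⇒≥ (no-gap i<m m<ᵏi)
        P<ᵏj = ℤ.≤-<-trans P≤ᵏi i<ᵏj
        σj<σ′i : σ j ℤ.< σ′ i
        σj<σ′i with ℤ.<-cmp (key P) (key i)
        ... | tri< P<ᵏi _ _ =
          subst (σ j ℤ.<_) (sym (kept-right-of-P (λ { refl → ℤ.<-irrefl refl m<ᵏi }) P<ᵏi))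
                (falling (<m⇒≤P i<m) (<m⇒≤P j<m) P<ᵏi i<ᵏj)
        ... | tri≈ _ P≈i _ with refl ← key-injective P<n (<m⇒<n i<m) P≈i =
          subst (σ j ℤ.<_) (sym (σ′-raised (inj₂ P-visible))) (σ<t j)
        ... | tri> _ _ i<ᵏP = contradiction i<ᵏP (ℤ.≤⇒≯ P≤ᵏi)

      peaked′ : Peaked m σ′
      peaked′ = record { peak = σ′-raised (inj₁ refl) ; rising = rising′ ; falling = falling′ }

      count-visible≤2 : count visible? positions ≤ 2
      count-visible≤2 =
        ℕ.≤-trans (count-⊆-∪ visible? (ℕ._≟ P) other? positions split)
                  (ℕ.+-mono-≤ count≡P≤1 (count≤1 other? positions (Unique.upTo⁺ n) nearest-unique))
        where
        other? : Decidable (λ j → Visible j × j ≢ P)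
        other? j = visible? j ×-dec ¬? (j ℕ.≟ P)
        split : ∀ {j} → j ∈ positions → Visible j → j ≡ P ⊎ (Visible j × j ≢ P)
        split {j} _ visible with j ℕ.≟ P
        ... | yes j≡P = inj₁ j≡P
        ... | no j≢P  = inj₂ (visible , j≢P)
        nearest : ∀ {j} → Visible j × j ≢ P → NearestBelow j
        nearest (visible , j≢P) with visible-left visible
        ... | inj₁ j≡P    = contradiction j≡P j≢P
        ... | inj₂ below  = below
        nearest-unique : ∀ {i j} → i ∈ positions → j ∈ positions →
                         Visible i × i ≢ P → Visible j × j ≢ P → i ≡ j
        nearest-unique i∈ j∈ i-other j-other
          with i<ᵏm , i-nearest ← nearest i-other | j<ᵏm , j-nearest ← nearest j-other =
          key-injective (∈-upTo⁻ i∈) (∈-upTo⁻ j∈)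
            (ℤ.≤-antisym (j-nearest (proj₁ (proj₁ i-other)) i<ᵏm) (i-nearest (proj₁ (proj₁ j-other)) j<ᵏm))

      Φ-next≤Φ+1 : Φ (suc m) ≤ Φ m ℕ.+ 1
      Φ-next≤Φ+1 = ℕ.≤-trans (count-⊆-∪ (rightOf? m) (rightOf? P) (ℕ._≟ P) positions split)
                                (ℕ.+-monoʳ-≤ (Φ m) count≡P≤1)
        where
        split : ∀ {j} → j ∈ positions → RightOf m j → RightOf P j ⊎ j ≡ P
        split {j} j∈ (j≤m , m<ᵏj) with j ℕ.≟ P | ℤ.<-cmp (key P) (key j)
        ... | yes j≡P | _               = inj₂ j≡P
        ... | no _    | tri< P<ᵏj _ _   = inj₁ (<m⇒≤P j<m , P<ᵏj)
          where j<m = ℕ.≤∧≢⇒< j≤m λ { refl → ℤ.<-irrefl refl m<ᵏj }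
        ... | no j≢P  | tri≈ _ P≈j _    = contradiction (sym (key-injective P<n (∈-upTo⁻ j∈) P≈j)) j≢P
        ... | no _    | tri> _ _ j<ᵏP   = ⊥-elim (no-gap j<m m<ᵏj j<ᵏP)
          where j<m = ℕ.≤∧≢⇒< j≤m λ { refl → ℤ.<-irrefl refl m<ᵏj }

      amortised : length (touched X p) ℕ.+ Φ (suc m) ≤ 3 ℕ.+ Φ m
      amortised = begin
        length (touched X p) ℕ.+ Φ (suc m)
          ≤⟨ ℕ.+-mono-≤ (ℕ.≤-trans length-touched≤ count-visible≤2) Φ-next≤Φ+1 ⟩
        2 ℕ.+ (Φ m ℕ.+ 1)
          ≡⟨ cong (2 ℕ.+_) (ℕ.+-comm (Φ m) 1) ⟩
        3 ℕ.+ Φ m ∎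
        where open ℕ.≤-Reasoning

    module Right (P<ᵏm : key P ℤ.< key m) where

      NearestAbove : Pred ℕ 0ℓ
      NearestAbove j = key m ℤ.< key j × (∀ {i} → i < m → key m ℤ.< key i → key j ℤ.≤ key i)

      visible-right : ∀ {j} → Visible j → (key P ℤ.≤ key j × key j ℤ.< key m) ⊎ NearestAbove j
      visible-right {j} visible@(j<m , unblocked) with ℤ.<-cmp (key j) (key m)
      ... | tri≈ _ j≈m _ = contradiction j≈m (key≢keym j<m)
      ... | tri< j<ᵏm _ _ =
        inj₁ (ℤ.≮⇒≥ (λ j<ᵏP → visible-not-past-P visible (inj₁ (j<ᵏP , P<ᵏm))) , j<ᵏm)
      ... | tri> _ _ m<ᵏj = inj₂ (m<ᵏj , nearest)
        where
        nearest : ∀ {i} → i < m → key m ℤ.< key i → key j ℤ.≤ key i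
        nearest i<m m<ᵏi = ℤ.≮⇒≥ λ i<ᵏj →
          ℤ.<-asym (unblocked (<m⇒<n i<m) (inj₂ (m<ᵏi , i<ᵏj)))
                   (falling (<m⇒≤P i<m) (<m⇒≤P j<m) (ℤ.<-trans P<ᵏm m<ᵏi) i<ᵏj)

      visible-between-P-and-m : ∀ {j} → j < m → key P ℤ.< key j → key j ℤ.< key m → Visible j
      visible-between-P-and-m {j} j<m P<ᵏj j<ᵏm = j<m , unblocked
        where
        unblocked : ∀ {l} → l < n → Between (key j) (key l) (key m) → σ l ℤ.< σ j
        unblocked _ (inj₂ (m<ᵏl , l<ᵏj)) = ⊥-elim (ℤ.<-asym (ℤ.<-trans m<ᵏl l<ᵏj) j<ᵏm)
        unblocked {l} _ (inj₁ (j<ᵏl , _)) with l ℕ.<? m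
        ... | yes l<m = falling (<m⇒≤P j<m) (<m⇒≤P l<m) P<ᵏj j<ᵏl
        ... | no l≮m  = unsearched<searched l≮m j<m

      kept-left-of-P : ∀ {i} → key i ℤ.< key P → σ′ i ≡ σ i
      kept-left-of-P {i} i<ᵏP = σ′-kept λ
        { (inj₁ refl) → ℤ.<-asym i<ᵏP P<ᵏm
        ; (inj₂ visible) → case visible-right visible of λ
          { (inj₁ (P≤ᵏi , _)) → ℤ.<⇒≱ i<ᵏP P≤ᵏi
          ; (inj₂ (m<ᵏi , _)) → ℤ.<-asym (ℤ.<-trans i<ᵏP P<ᵏm) m<ᵏi } }

      rising′ : ∀ {i j} → i ≤ m → j ≤ m → key i ℤ.< key j → key j ℤ.≤ key m → σ′ i ℤ.≤ σ′ j
      rising′ {i} {j} i≤m j≤m i<ᵏj j≤ᵏm with ℕ.m≤n⇒m<n∨m≡n j≤m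
      ... | inj₂ refl = subst (σ′ i ℤ.≤_) (sym (σ′-raised (inj₁ refl))) (σ′≤t i)
      ... | inj₁ j<m with key P ℤ.<? key j
      ...   | yes P<ᵏj = subst (σ′ i ℤ.≤_) (sym (σ′-raised (inj₂ visible))) (σ′≤t i)
        where visible = visible-between-P-and-m j<m P<ᵏj (ℤ.≤∧≢⇒< j≤ᵏm (key≢keym j<m))
      ...   | no P≮ᵏj = begin
        σ′ i ≡⟨ kept-left-of-P (ℤ.<-≤-trans i<ᵏj j≤ᵏP) ⟩
        σ i  ≤⟨ rising (<m⇒≤P i<m) (<m⇒≤P j<m) i<ᵏj j≤ᵏP ⟩
        σ j  ≤⟨ σ≤σ′ j ⟩
        σ′ j ∎
        where
        open ℤ.≤-Reasoning
        j≤ᵏP = ℤ.≮⇒≥ P≮ᵏj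
        i<m : i < m
        i<m = ℕ.≤∧≢⇒< i≤m λ { refl → ℤ.<-asym (ℤ.<-≤-trans i<ᵏj j≤ᵏP) P<ᵏm }

      falling′ : ∀ {i j} → i ≤ m → j ≤ m → key m ℤ.< key i → key i ℤ.< key j → σ′ j ℤ.< σ′ i
      falling′ {i} {j} i≤m j≤m m<ᵏi i<ᵏj = begin-strict
        σ′ j ≡⟨ σ′-kept not-raised ⟩
        σ j  <⟨ falling (<m⇒≤P i<m) (<m⇒≤P j<m) (ℤ.<-trans P<ᵏm m<ᵏi) i<ᵏj ⟩
        σ i  ≤⟨ σ≤σ′ i ⟩
        σ′ i ∎
        where
        open ℤ.≤-Reasoning
        i<m : i < m
        i<m = ℕ.≤∧≢⇒< i≤m λ { refl → ℤ.<-irrefl refl m<ᵏi }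
        j<m : j < m
        j<m = ℕ.≤∧≢⇒< j≤m λ { refl → ℤ.<-asym m<ᵏi i<ᵏj }
        not-raised : ¬ Raised j
        not-raised (inj₁ refl) = ℤ.<-asym m<ᵏi i<ᵏj
        not-raised (inj₂ visible) with visible-right visible
        ... | inj₁ (_ , j<ᵏm)      = ℤ.<-asym (ℤ.<-trans m<ᵏi i<ᵏj) j<ᵏm
        ... | inj₂ (_ , nearest)  = ℤ.<⇒≱ i<ᵏj (nearest i<m m<ᵏi)

      peaked′ : Peaked m σ′
      peaked′ = record { peak = σ′-raised (inj₁ refl) ; rising = rising′ ; falling = falling′ }

      Mid Above High : Pred ℕ 0ℓ
      Mid j   = RightOf P j × key j ℤ.< key m
      High j  = RightOf P j × key m ℤ.< key j
      Above j = Visible j × key m ℤ.< key j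

      mid? : Decidable Mid
      mid? j = rightOf? P j ×-dec key j ℤ.<? key m

      high? : Decidable High
      high? j = rightOf? P j ×-dec key m ℤ.<? key j

      above? : Decidable Above
      above? j = visible? j ×-dec key m ℤ.<? key j

      count-visible≤mid+2 : count visible? positions ≤ 1 ℕ.+ (count mid? positions ℕ.+ 1)
      count-visible≤mid+2 =
        ℕ.≤-trans (count-⊆-∪ visible? (ℕ._≟ P) (λ j → mid? j ⊎-dec above? j) positions split)
                  (ℕ.+-mono-≤ count≡P≤1 (ℕ.≤-trans (count-∪ mid? above? positions)
                                                   (ℕ.+-monoʳ-≤ (count mid? positions) count-above≤1)))
        where
        split : ∀ {j} → j ∈ positions → Visible j → j ≡ P ⊎ Mid j ⊎ Above j
        split {j} j∈ visible with visible-right visible | j ℕ.≟ P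
        ... | inj₂ (m<ᵏj , _)     | _       = inj₂ (inj₂ (visible , m<ᵏj))
        ... | inj₁ _              | yes j≡P = inj₁ j≡P
        ... | inj₁ (P≤ᵏj , j<ᵏm)  | no j≢P  =
          inj₂ (inj₁ ((<m⇒≤P (proj₁ visible) , ℤ.≤∧≢⇒< P≤ᵏj P≉j) , j<ᵏm))
          where P≉j = λ P≈j → j≢P (sym (key-injective P<n (∈-upTo⁻ j∈) P≈j))
        count-above≤1 : count above? positions ≤ 1
        count-above≤1 = count≤1 above? positions (Unique.upTo⁺ n) nearest-unique
          where
          nearest : ∀ {j} → Above j → NearestAbove j
          nearest (visible , m<ᵏj) with visible-right visible
          ... | inj₁ (_ , j<ᵏm) = ⊥-elim (ℤ.<-asym m<ᵏj j<ᵏm)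
          ... | inj₂ above      = above
          nearest-unique : ∀ {i j} → i ∈ positions → j ∈ positions → Above i → Above j → i ≡ j
          nearest-unique i∈ j∈ i-above j-above
            with m<ᵏi , i-nearest ← nearest i-above | m<ᵏj , j-nearest ← nearest j-above =
            key-injective (∈-upTo⁻ i∈) (∈-upTo⁻ j∈)
              (ℤ.≤-antisym (i-nearest (proj₁ (proj₁ j-above)) m<ᵏj) (j-nearest (proj₁ (proj₁ i-above)) m<ᵏi))

      Φ-next≤high : Φ (suc m) ≤ count high? positions
      Φ-next≤high = count-mono (rightOf? m) high? positions λ { _ (j≤m , m<ᵏj) → high j≤m m<ᵏj }
        where
        high : ∀ {j} → j ≤ m → key m ℤ.< key j → High j
        high j≤m m<ᵏj =
          (<m⇒≤P (ℕ.≤∧≢⇒< j≤m λ { refl → ℤ.<-irrefl refl m<ᵏj }) , ℤ.<-trans P<ᵏm m<ᵏj) , m<ᵏj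

      mid+high≤Φ : count mid? positions ℕ.+ count high? positions ≤ Φ m
      mid+high≤Φ = count-disjoint-⊆ (rightOf? P) mid? high? positions
        (λ { _ (_ , j<ᵏm) (_ , m<ᵏj) → ℤ.<-asym j<ᵏm m<ᵏj })
        (λ { _ (inj₁ (right , _)) → right ; _ (inj₂ (right , _)) → right })

      amortised : length (touched X p) ℕ.+ Φ (suc m) ≤ 3 ℕ.+ Φ m
      amortised = begin
        length (touched X p) ℕ.+ Φ (suc m)
          ≤⟨ ℕ.+-mono-≤ (ℕ.≤-trans length-touched≤ count-visible≤mid+2) Φ-next≤high ⟩
        (1 ℕ.+ (mid ℕ.+ 1)) ℕ.+ high
          ≡⟨ cong suc (trans (ℕ.+-assoc mid 1 high) (ℕ.+-suc mid high)) ⟩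
        2 ℕ.+ (mid ℕ.+ high)
          ≤⟨ ℕ.+-monoʳ-≤ 2 mid+high≤Φ ⟩
        2 ℕ.+ Φ m
          ≤⟨ ℕ.n≤1+n _ ⟩
        3 ℕ.+ Φ m ∎
        where
        open ℕ.≤-Reasoning
        mid = count mid? positions
        high = count high? positions

    peaked′ : Peaked m σ′
    peaked′ with ℤ.<-cmp (key m) (key P)
    ... | tri< m<ᵏP _ _ = Left.peaked′ m<ᵏP
    ... | tri≈ _ m≈P _  = contradiction (sym m≈P) keyP≢keym
    ... | tri> _ _ P<ᵏm = Right.peaked′ P<ᵏm

    amortised : length (touched X p) ℕ.+ Φ (suc m) ≤ 3 ℕ.+ Φ m
    amortised with ℤ.<-cmp (key m) (key P)
    ... | tri< m<ᵏP _ _ = Left.amortised m<ᵏP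
    ... | tri≈ _ m≈P _  = contradiction (sym m≈P) keyP≢keym
    ... | tri> _ _ P<ᵏm = Right.amortised P<ᵏm

  next-staircase : ∀ {m X σ} (m<n : m < n) (stair : Staircase m X σ) →
                   Staircase (suc m) (Step.X′ m<n stair) (Step.σ′ m<n stair)
  next-staircase {zero}  m<n stair = Step.staircase′ m<n stair (FirstStep.peaked′ m<n stair)
  next-staircase {suc _} m<n stair = Step.staircase′ m<n stair (NextStep.peaked′ m<n stair)

  amortised : ∀ {m X σ} (m<n : m < n) → Staircase m X σ →
              length (touched X (key m , + suc m)) ℕ.+ Φ (suc m) ≤ 3 ℕ.+ Φ m
  amortised {zero}  m<n stair = FirstStep.amortised m<n stair
  amortised {suc _} m<n stair = NextStep.amortised m<n stair

  -- Greedy advances time by ℤ addition, which does not reduce to + suc (suc m); hence t ≡ + suc m.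
  run : ∀ l {m X σ t} {ks : ℕ → ℤ} → t ≡ + suc m → (∀ i → ks i ≡ key (i ℕ.+ m)) → m ℕ.+ l ≡ n →
        Staircase m X σ → greedyTouched X t (applyUpTo ks l) ≤ 3 * l ℕ.+ Φ m
  run zero _ _ _ _ = z≤n
  run (suc l) {m} {ks = ks} refl ks≡ m+l≡n stair rewrite ks≡ 0 =
    sum-amortised (amortised m<n stair)
                  (run l t′≡ ks′≡ (trans (sym (ℕ.+-suc m l)) m+l≡n) (next-staircase m<n stair))
    where
    m<n : m < n
    m<n = subst (m <_) m+l≡n (ℕ.m<m+n m (s≤s z≤n))
    t′≡ : + suc m ℤ.+ + 1 ≡ + suc (suc m)
    t′≡ = cong (+_ ∘ suc) (ℕ.+-comm m 1)
    ks′≡ : ∀ i → ks (suc i) ≡ key (i ℕ.+ suc m)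
    ks′≡ i = trans (ks≡ (suc i)) (cong key (sym (ℕ.+-suc i m)))
    sum-amortised : ∀ {a b c d} → a ℕ.+ b ≤ 3 ℕ.+ c → d ≤ 3 * l ℕ.+ b → a ℕ.+ d ≤ 3 * suc l ℕ.+ c
    sum-amortised {a} {b} {c} {d} a+b≤3+c d≤3l+b = begin
      a ℕ.+ d                 ≤⟨ ℕ.+-monoʳ-≤ a d≤3l+b ⟩
      a ℕ.+ (3 * l ℕ.+ b)     ≡⟨ regroup a b l ⟩
      (a ℕ.+ b) ℕ.+ 3 * l     ≤⟨ ℕ.+-monoˡ-≤ (3 * l) a+b≤3+c ⟩
      (3 ℕ.+ c) ℕ.+ 3 * l     ≡⟨ regroup′ c l ⟩
      3 * suc l ℕ.+ c         ∎
      where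
      open ℕ.≤-Reasoning
      regroup : ∀ a b l → a ℕ.+ (3 * l ℕ.+ b) ≡ (a ℕ.+ b) ℕ.+ 3 * l
      regroup = solve-∀
      regroup′ : ∀ c l → (3 ℕ.+ c) ℕ.+ 3 * l ≡ 3 * suc l ℕ.+ c
      regroup′ = solve-∀

  initialTree : List Point
  initialTree = applyUpTo (λ j → key j , -[1+ j ]) n

  initial-staircase : Staircase 0 initialTree -[1+_]
  initial-staircase = record
    { on-column  = λ w∈ → case ∈-applyUpTo⁻ (λ j → key j , -[1+ j ]) w∈ of λ
                     { (j , j<n , refl) → j , j<n , refl , ℤ.≤-refl }
    ; top∈       = ∈-applyUpTo⁺ (λ j → key j , -[1+ j ])
    ; unique     = Unique.applyUpTo⁺₁ _ n λ i<j _ same →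
                     ℕ.<-irrefl (ℤ.-[1+-injective (cong proj₂ same)) i<j
    ; unsearched = λ _ → refl
    ; searched   = λ ()
    ; peaked     = tt }

  greedyTouched-initialTree≤3n : greedyTouched initialTree (+ 1) (applyUpTo key n) ≤ 3 * n
  greedyTouched-initialTree≤3n =
    ℕ.≤-trans (run n refl (λ i → cong key (sym (ℕ.+-identityʳ i))) refl initial-staircase)
              (ℕ.≤-reflexive (ℕ.+-identityʳ (3 * n)))

-- Preorder sequences

module Preorder {n : ℕ} (π : Fin n → Fin n) (π-preorder : IsPreorder n π) where

  -- Positions j ≥ n get the junk key + 0; they never occur.
  key : ℕ → ℤ
  key j with j ℕ.<? n
  ... | yes j<n = val π (fromℕ< j<n)
  ... | no _    = + 0

  key-fromℕ< : ∀ {j} (j<n : j < n) → key j ≡ val π (fromℕ< j<n)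
  key-fromℕ< {j} j<n with j ℕ.<? n
  ... | yes _   = refl
  ... | no j≮n  = contradiction j<n j≮n

  key-toℕ : ∀ i → key (toℕ i) ≡ val π i
  key-toℕ i = trans (key-fromℕ< (Fin.toℕ<n i)) (cong (val π) (Fin.fromℕ<-toℕ i (Fin.toℕ<n i)))

  key-injective : ∀ {i j} → i < n → j < n → key i ≡ key j → i ≡ j
  key-injective {i} {j} i<n j<n same = begin
    i                    ≡⟨ Fin.toℕ-fromℕ< i<n ⟨
    toℕ (fromℕ< i<n)     ≡⟨ cong toℕ (proj₁ π-preorder (Fin.toℕ-injective same-value)) ⟩
    toℕ (fromℕ< j<n)     ≡⟨ Fin.toℕ-fromℕ< j<n ⟩
    j                    ∎
    where
    open ≡-Reasoning
    same-value : toℕ (π (fromℕ< i<n)) ≡ toℕ (π (fromℕ< j<n))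
    same-value = ℕ.suc-injective (ℤ.+-injective (trans (sym (key-fromℕ< i<n)) (trans same (key-fromℕ< j<n))))

  avoids-231 : ∀ {a b c} → a < b → b < c → c < n → key c ℤ.< key a → key a ℤ.< key b → ⊥
  avoids-231 {a} {b} {c} a<b b<c c<n c<ᵏa a<ᵏb =
    proj₂ π-preorder (fromℕ< a<n) (fromℕ< b<n) (fromℕ< c<n)
      (fromℕ<-mono a<n b<n a<b) (fromℕ<-mono b<n c<n b<c) (π-mono c<n a<n c<ᵏa , π-mono a<n b<n a<ᵏb)
    where
    b<n = ℕ.<-trans b<c c<n
    a<n = ℕ.<-trans a<b b<n
    fromℕ<-mono : ∀ {i j} (i<n : i < n) (j<n : j < n) → i < j → fromℕ< i<n Fin.< fromℕ< j<n
    fromℕ<-mono i<n j<n = subst₂ _<_ (sym (Fin.toℕ-fromℕ< i<n)) (sym (Fin.toℕ-fromℕ< j<n))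
    π-mono : ∀ {i j} (i<n : i < n) (j<n : j < n) → key i ℤ.< key j →
             π (fromℕ< i<n) Fin.< π (fromℕ< j<n)
    π-mono i<n j<n i<ᵏj =
      ℕ.s<s⁻¹ (ℤ.drop‿+<+ (subst₂ ℤ._<_ (key-fromℕ< i<n) (key-fromℕ< j<n) i<ᵏj))

  open GreedyOn231Avoiding n key key-injective avoids-231

  seqOf≡ : seqOf n π ≡ applyUpTo key n
  seqOf≡ = map-allFin≡applyUpTo (sym ∘ key-toℕ)

  preorderInitTree≡ : preorderInitTree n π ≡ initialTree
  preorderInitTree≡ = map-allFin≡applyUpTo λ i → cong (_, -[1+ toℕ i ]) (sym (key-toℕ i))

  mirror-preorderInitTree : mirror (preorderInitTree n π) ≡ searchPoints (seqOf n π)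
  mirror-preorderInitTree rewrite preorderInitTree≡ | seqOf≡ = mirror-applyUpTo n key

  greedyCost≤4n : greedyCost (preorderInitTree n π) (seqOf n π) ≤ 4 * n
  greedyCost≤4n rewrite preorderInitTree≡ | seqOf≡ | length-applyUpTo key n =
    ℕ.+-monoʳ-≤ n greedyTouched-initialTree≤3n

-- The bound holds for n = 0 as well.
corollary3 : Σ ℕ (λ c → c ≥ 1 × ((n : ℕ) → n ≥ 1 → (π : Fin n → Fin n) → IsPreorder n π →
    (mirror (preorderInitTree n π) ≡ searchPoints (seqOf n π))
    × IsPreorder n π
    × (greedyCost (preorderInitTree n π) (seqOf n π) ≤ c * n)))
corollary3 = 4 , s≤s z≤n , λ n _ π π-preorder →
  Preorder.mirror-preorderInitTree π π-preorder , π-preorder , Preorder.greedyCost≤4n π π-preorder
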